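{- Let $A,A'$ be automata, $L,R,J\subseteq(Ctrl\times Ctrl')\times(Sto\times Sto')$, and $\mathcal{Q},\mathcal{S}\subseteq Sto\times Sto'$. Suppose $an$ is a valid annotation of $\prod(A,A',L,R,J)$ for $\{\mathcal{Q}\}\{\mathcal{S}\}$. If $\widehat{an}(i,j)\subseteq L\cup R\cup J\cup[fin|fin']$ for every control point $(i,j)$, then $\prod(A,A',L,R,J)$ is manifestly $\mathcal{Q}$-adequate.
   Context: An automaton is $(Ctrl,Sto,init,fin,\Rightarrow)$ with $Sto$ a set, $Ctrl$ a finite set containing distinct $init,fin$, and ${\Rightarrow}\subseteq(Ctrl\times Sto)^2$ with $(n,s)\Rightarrow(m,t)$ implying $n\ne fin$ and $n\ne m$. For $A=(Ctrl,Sto,init,fin,\Rightarrow)$, $A'=(Ctrl',Sto',init',fin',\Rightarrow')$, $\prod(A,A',L,R,J)$ has control points $Ctrl\times Ctrl'$, stores $Sto\times Sto'$, initial $(init,init')$, final $(fin,fin')$, and $((n,n'),(s,s'))\Rightarrow((m,m'),(t,t'))$ iff: ($\in L$, $(n,s)\Rightarrow(m,t)$, $(n',s')=(m',t')$) or ($\in R$, $(n,s)=(m,t)$, $(n',s')\Rightarrow'(m',t')$) or ($\in J$, $(n,s)\Rightarrow(m,t)$, $(n',s')\Rightarrow'(m',t')$). An annotation for $\{\mathcal{Q}\}\{\mathcal{S}\}$ maps each control point $(i,j)$ to a relation $an(i,j)\subseteq Sto\times Sto'$ with $an(init,init')=\mathcal{Q}$ and $an(fin,fin')=\mathcal{S}$;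 it is valid if whenever $(s,s')\in an(n,n')$ and $((n,n'),(s,s'))\Rightarrow((m,m'),(t,t'))$ then $(t,t')\in an(m,m')$. The lifting is $\widehat{an}(i,j)=\{((k,k'),(s,s')) : (s,s')\in an(i,j)\}$, a set of states. $[fin|fin']$ is the set of states with control $(fin,fin')$. Manifestly $\mathcal{Q}$-adequate: every state reachable from some $((init,init'),(s,s'))$ with $(s,s')\in\mathcal{Q}$ lies in $L\cup R\cup J\cup[fin|fin']$. -}

module Defs where

open import Level using (Level; _⊔_; suc)
open import Data.Nat using (ℕ)
open import Data.Fin using (Fin)
open import Data.Product using (Σ; _×_; _,_; ∃)
open import Data.Sum using (_⊎_)
open import Relation.Nullary using (¬_)
open import Relation.Binary.PropositionalEquality using (_≡_)
open import Relation.Binary.Construct.Closure.ReflexiveTransitive using (Star)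
open import Function.Bundles using (Surjection)
open import Relation.Binary.PropositionalEquality using (setoid)

Pred : ∀ {a} → Set a → (ℓ : Level) → Set (a ⊔ suc ℓ)
Pred A ℓ = A → Set ℓ

IsFinite : ∀ {a} → Set a → Set a
IsFinite A = Σ ℕ λ n → Surjection (setoid (Fin n)) (setoid A)

record Automaton (c s ℓ : Level) : Set (suc (c ⊔ s ⊔ ℓ)) where
  field
    Ctrl     : Set c
    Sto      : Set s
    finite   : IsFinite Ctrl
    init     : Ctrl
    fin      : Ctrl
    init≢fin : ¬ (init ≡ fin)
    _⇒_      : Ctrl × Sto → Ctrl × Sto → Set ℓ
    ⇒-notFin : ∀ {n s m t} → (n , s) ⇒ (m , t) → ¬ (n ≡ fin)
    ⇒-move   : ∀ {n s m t} → (n , s) ⇒ (m , t) → ¬ (n ≡ m)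

module Product {c s ℓ c' s' ℓ' : Level}
               (A : Automaton c s ℓ) (A' : Automaton c' s' ℓ') where
  open Automaton A
  open Automaton A' renaming (Ctrl to Ctrl'; Sto to Sto'; init to init'; fin to fin'; _⇒_ to _⇒'_) hiding (finite; init≢fin; ⇒-notFin; ⇒-move)

  PState : Set (c ⊔ c' ⊔ s ⊔ s')
  PState = (Ctrl × Ctrl') × (Sto × Sto')

  Step : ∀ {k} → (L R J : Pred PState k) → PState → PState → Set (c ⊔ c' ⊔ s ⊔ s' ⊔ ℓ ⊔ ℓ' ⊔ k)
  Step L R J ((n , n') , (s , s')) ((m , m') , (t , t')) =
      (L ((n , n') , (s , s')) × ((n , s) ⇒ (m , t)) × ((n' , s') ≡ (m' , t')))
    ⊎ (R ((n , n') , (s , s')) × ((n , s) ≡ (m , t)) × ((n' , s') ⇒' (m' , t')))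
    ⊎ (J ((n , n') , (s , s')) × ((n , s) ⇒ (m , t)) × ((n' , s') ⇒' (m' , t')))

  record Annotation {r} (Q S : Pred (Sto × Sto') r) : Set (c ⊔ c' ⊔ s ⊔ s' ⊔ suc r) where
    field
      an      : Ctrl → Ctrl' → Pred (Sto × Sto') r
      an-init : ∀ p → (an init init' p → Q p) × (Q p → an init init' p)
      an-fin  : ∀ p → (an fin fin' p → S p) × (S p → an fin fin' p)

  Valid : ∀ {k r} {Q S : Pred (Sto × Sto') r} → (L R J : Pred PState k) → Annotation Q S → Set (c ⊔ c' ⊔ s ⊔ s' ⊔ ℓ ⊔ ℓ' ⊔ k ⊔ r)
  Valid L R J record { an = an } =
    ∀ n n' s s' m m' t t' → an n n' (s , s') →
      Step L R J ((n , n') , (s , s')) ((m , m') , (t , t')) → an m m' (t , t')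

  lift : ∀ {r} → (Ctrl → Ctrl' → Pred (Sto × Sto') r) → Ctrl → Ctrl' → Pred PState r
  lift an i j ((_ , _) , p) = an i j p

  FinFin : Pred PState (c ⊔ c')
  FinFin ((n , n') , _) = (n , n') ≡ (fin , fin')

  Union : ∀ {k} → (L R J : Pred PState k) → Pred PState (c ⊔ c' ⊔ k)
  Union L R J σ = L σ ⊎ R σ ⊎ J σ ⊎ FinFin σ

  ManifestlyAdequate : ∀ {k r} → (L R J : Pred PState k) → Pred (Sto × Sto') r → Set _
  ManifestlyAdequate L R J Q =
    ∀ (p : Sto × Sto') (σ : PState) → Q p →
      Star (Step L R J) ((init , init') , p) σ → Union L R J σ

  Lemma3p14 : (k r : Level) → Set _
  Lemma3p14 k r =
    (L R J : Pred PState k) (Q S : Pred (Sto × Sto') r) (an : Annotation Q S)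
      → Valid L R J an
      → (∀ (i : Ctrl) (j : Ctrl') (σ : PState) → lift (Annotation.an an) i j σ → Union L R J σ)
      → ManifestlyAdequate L R J Q

{-# OPTIONS --safe #-}
module Submission where

-- Validity says exactly that "the state satisfies the annotation at its own control point"
-- is an invariant of the product's transition relation; it holds initially because
-- an(init,init') = Q, hence at every reachable state, and the covering hypothesis then
-- places that state in L ∪ R ∪ J ∪ [fin|fin'].

open import Defs
open import Level using (Level)
open import Data.Product using (_×_; _,_; proj₂)
open import Relation.Binary.Core using (Rel)
open import Relation.Binary.Definitions using (_Respects_)
open import Relation.Binary.Construct.Closure.ReflexiveTransitive using (Star; ε; _◅_)

respects-star : ∀ {a ℓ p} {A : Set a} {T : Rel A ℓ} {P : A → Set p} →
                P Respects T → P Respects Star T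
respects-star preserve ε        Px = Px
respects-star preserve (t ◅ ts) Px = respects-star preserve ts (preserve t Px)

module _ {c s ℓ c' s' ℓ' : Level} (A : Automaton c s ℓ) (A' : Automaton c' s' ℓ') where
  open Product A A'
  open Automaton A using (Ctrl; Sto)
  open Automaton A' using () renaming (Ctrl to Ctrl'; Sto to Sto')

  -- ⋃ᵢⱼ (an^(i,j) ∩ [i|j]): the annotation is read at the state's own control point.
  AnnotatedAt : ∀ {r} → (Ctrl → Ctrl' → Pred (Sto × Sto') r) → Pred PState r
  AnnotatedAt an ((i , j) , p) = an i j p

  valid⇒annotatedAt-respects-step : ∀ {k r} {Q S : Pred (Sto × Sto') r}
    (L R J : Pred PState k) (an : Annotation Q S) →
    Valid L R J an → AnnotatedAt (Annotation.an an) Respects Step L R J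
  valid⇒annotatedAt-respects-step L R J an valid
    {(n , n') , (u , u')} {(m , m') , (t , t')} step holds =
    valid n n' u u' m m' t t' holds step

lemma3p14 : ∀ {c s ℓ c' s' ℓ' : Level} (k r : Level)
    (A : Automaton c s ℓ) (A' : Automaton c' s' ℓ')
    → Product.Lemma3p14 A A' k r
lemma3p14 k r A A' L R J Q S an valid covered p σ@((i , j) , _) Qp run =
  covered i j σ annotated-σ
  where
  open Product A A'
  annotated-σ : AnnotatedAt A A' (Annotation.an an) σ
  annotated-σ = respects-star (valid⇒annotatedAt-respects-step A A' L R J an valid) run
                  (proj₂ (Annotation.an-init an p) Qp)
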